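{- Let $G$ be an $(s,k)$-edge-connected graph such that $k\geq 2$ and $\deg(s)\geq 4$. Let $I_1,I_2$ be disjoint maximal independent sets of $L(G,s,k)$, each of size at least $2$, and let $A_1,A_2$ be dangerous sets of $G$ such that $A_i$ contains the end other than $s$ of every edge in $I_i$ ($i=1,2$). Then $A_1\setminus A_2$ or $A_2\setminus A_1$ is dangerous.
   Context: All graphs are finite loopless multigraphs. $\delta(X)$ is the set of edges with exactly one end in $X$. A graph $G$ is $(s,k)$-edge-connected if $G$ has at least three vertices, $s\in V(G)$, $k$ is a positive integer, and any two vertices of $G$ different from $s$ are joined by $k$ pairwise edge-disjoint paths in $G$ (which may pass through $s$). Lifting edges $sv,sw$ means deleting them and adding $vw$ if $v\ne w$, only deleting them if $v=w$; result $G_{v,w}$. $sv,sw$ are $k$-liftable if $G_{v,w}$ is $(s,k)$-edge-connected. $L(G,s,k)$ has vertex set the edges of $G$ incident with $s$, adjacent iff $k$-liftable. A set $A\subseteq V(G)\setminus\{s\}$ is dangerous if $A\ne\emptyset$, $V(G)\setminus(A\cup\{s\})\neq\emptyset$ and $|\delta(A)|\le k+1$. -}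

module Defs where

open import Data.Nat using (ℕ; zero; suc; _≤_; _+_)
open import Data.Bool using (Bool; true; false; if_then_else_; _∨_; _xor_; not)
open import Data.Fin using (Fin; zero; suc; _≟_)
open import Data.Fin.Subset using (Subset; _∈_; _∉_; _∪_; ⁅_⁆; ∣_∣; _─_)
open import Data.Vec using (lookup)
open import Data.List using (List; []; _∷_; length; _++_)
import Data.List as L
open import Data.List.Membership.Propositional as LM using ()
open import Data.List.Relation.Unary.All using (All)
open import Data.List.Relation.Unary.Unique.Propositional using (Unique)
open import Data.Product using (Σ; _×_; _,_; proj₁; proj₂)
open import Data.Sum using (_⊎_)
open import Relation.Binary.PropositionalEquality using (_≡_; _≢_)
open import Relation.Nullary using (¬_)
open import Relation.Nullary.Decidable using (⌊_⌋)

-- A finite loopless multigraph on vertex set Fin n is a list of edges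
-- (pairs of endpoints); an edge is identified by its position in the list.
Edges : ℕ → Set
Edges n = List (Fin n × Fin n)

module _ {n : ℕ} where

  EIdx : Edges n → Set
  EIdx es = Fin (length es)

  edge : (es : Edges n) → EIdx es → Fin n × Fin n
  edge es i = L.lookup es i

  Loopless : Edges n → Set
  Loopless es = All (λ e → proj₁ e ≢ proj₂ e) es

  countB : {A : Set} → (A → Bool) → List A → ℕ
  countB p [] = 0
  countB p (x ∷ xs) = if p x then suc (countB p xs) else countB p xs

  incB : Fin n → Fin n × Fin n → Bool
  incB x e = ⌊ proj₁ e ≟ x ⌋ ∨ ⌊ proj₂ e ≟ x ⌋

  Inc : Fin n → Fin n × Fin n → Set
  Inc x e = proj₁ e ≡ x ⊎ proj₂ e ≡ x

  deg : Edges n → Fin n → ℕ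
  deg es x = countB (incB x) es

  cut : Edges n → Subset n → ℕ
  cut es A = countB (λ e → lookup A (proj₁ e) xor lookup A (proj₂ e)) es

  otherEnd : Fin n → Fin n × Fin n → Fin n
  otherEnd s e = if ⌊ proj₁ e ≟ s ⌋ then proj₂ e else proj₁ e

  Joins : Fin n × Fin n → Fin n → Fin n → Set
  Joins e u w = (proj₁ e ≡ u × proj₂ e ≡ w) ⊎ (proj₁ e ≡ w × proj₂ e ≡ u)

  data IsWalk (es : Edges n) : Fin n → Fin n → List (EIdx es) → List (Fin n) → Set where
    nil  : ∀ {u} → IsWalk es u u [] (u ∷ [])
    cons : ∀ {u w v ps vs} (e : EIdx es) → Joins (edge es e) u w →
           IsWalk es w v ps vs → IsWalk es u v (e ∷ ps) (u ∷ vs)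

  record Path (es : Edges n) (u v : Fin n) : Set where
    field
      pedges : List (EIdx es)
      pverts : List (Fin n)
      walk   : IsWalk es u v pedges pverts
      simple : Unique pverts
  open Path public

  EdgeDisjoint : {es : Edges n} {u v : Fin n} {k : ℕ} → (Fin k → Path es u v) → Set
  EdgeDisjoint {es} {k = k} P = (i j : Fin k) → i ≢ j →
    (e : EIdx es) → e LM.∈ pedges (P i) → ¬ (e LM.∈ pedges (P j))

  SKConn : Edges n → Fin n → ℕ → Set
  SKConn es s k = 3 ≤ n × 1 ≤ k ×
    ((u v : Fin n) → u ≢ s → v ≢ s → u ≢ v →
      Σ (Fin k → Path es u v) EdgeDisjoint)

  dropIdx : (es : Edges n) → (EIdx es → Bool) → Edges n
  dropIdx [] p = []
  dropIdx (e ∷ es) p = if p zero then dropIdx es (λ x → p (suc x))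
                                  else e ∷ dropIdx es (λ x → p (suc x))

  liftE : (es : Edges n) → Fin n → EIdx es → EIdx es → Edges n
  liftE es s i j =
    dropIdx es (λ x → ⌊ x ≟ i ⌋ ∨ ⌊ x ≟ j ⌋) ++
    (if ⌊ v ≟ w ⌋ then [] else (v , w) ∷ [])
    where
      v = otherEnd s (edge es i)
      w = otherEnd s (edge es j)

  -- vertices of L(G,s,k): edges incident with s
  IsLVert : (es : Edges n) → Fin n → EIdx es → Set
  IsLVert es s i = Inc s (edge es i)

  -- adjacency in L(G,s,k): two distinct edges at s that are k-liftable
  Liftable : (es : Edges n) → Fin n → ℕ → EIdx es → EIdx es → Set
  Liftable es s k i j = i ≢ j × IsLVert es s i × IsLVert es s j ×
                        SKConn (liftE es s i j) s k

  IndepL : (es : Edges n) → Fin n → ℕ → Subset (length es) → Set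
  IndepL es s k I = ((i : EIdx es) → i ∈ I → IsLVert es s i) ×
    ((i j : EIdx es) → i ∈ I → j ∈ I → ¬ Liftable es s k i j)

  MaxIndepL : (es : Edges n) → Fin n → ℕ → Subset (length es) → Set
  MaxIndepL es s k I = IndepL es s k I ×
    ((f : EIdx es) → IsLVert es s f → f ∉ I → ¬ IndepL es s k (I ∪ ⁅ f ⁆))

  Dangerous : Edges n → Fin n → ℕ → Subset n → Set
  Dangerous es s k A = s ∉ A × (Σ (Fin n) λ a → a ∈ A) ×
    (Σ (Fin n) λ b → b ∉ A × b ≢ s) × cut es A ≤ suc k

{-# OPTIONS --safe #-}
-- Lifting two edges sv, sw with v, w inside a set B ∌ s lowers |δ(B)| by two, while
-- (s,k)-edge-connectivity (the easy direction of Menger) forces |δ(B)| ≥ k; so no such pair is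
-- liftable when B is dangerous. Hence if A₁ ⊆ A₂, adding any edge of I₂ to I₁ keeps it independent,
-- contradicting maximality; thus A₁ ─ A₂ and A₂ ─ A₁ are nonempty. Posimodularity
-- |δ(A₁ ─ A₂)| + |δ(A₂ ─ A₁)| ≤ |δ(A₁)| + |δ(A₂)| ≤ 2(k + 1) then makes one of them dangerous.
module Submission where

open import Defs
open import Algebra.Properties.CommutativeSemigroup using (interchange)
open import Data.Bool using (Bool; true; false; if_then_else_; _∨_; _∧_; not; _xor_; T)
open import Data.Bool.Properties using (∨-zeroʳ)
open import Data.Empty using (⊥-elim)
open import Data.Fin using (Fin; zero; suc; _≟_)
open import Data.Fin.Properties using (injective⇒≤; suc-injective)
open import Data.Fin.Subset using (Subset; _∈_; _∉_; _⊆_; _∪_; _─_; ⁅_⁆; ∣_∣; Nonempty)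
open import Data.Fin.Subset.Properties
  using (x∈p∪q⁻; x∈⁅y⁆⇒x≡y; _∈?_; p─q⊆p; nonempty?; x∈p∧x∉q⇒x∈p─q; Empty-unique; ∣⊥∣≡0)
open import Data.List using (List; []; _∷_; length; _++_)
import Data.List as L
open import Data.List.Membership.Propositional as LM using ()
open import Data.List.Relation.Unary.Any using (here; there)
open import Data.Nat using (ℕ; suc; _≤_; _+_; z≤n; s≤s; _≤?_; _≤ᵇ_)
open import Data.Nat.Properties
  using ( ≤-refl; ≤-trans; 1+n≰n; ≤ᵇ⇒≤; n≤1+n; m<n⇒n≢0; +-mono-≤; +-mono-<; ≰⇒>; <⇒≱; +-identityʳ
        ; +-commutativeSemigroup; module ≤-Reasoning)
open import Data.Product using (Σ; _×_; _,_; proj₁; proj₂)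
open import Data.Sum using (_⊎_; inj₁; inj₂)
import Data.Sum as Sum
open import Data.Vec using (lookup; _∷_; here; there)
open import Data.Vec.Properties using ([]=⇒lookup; lookup⇒[]=)
open import Function.Definitions using (Injective)
open import Relation.Binary.PropositionalEquality using (_≡_; _≢_; refl; sym; trans; cong; cong₂; subst)
open import Relation.Nullary using (¬_; yes; no)
open import Relation.Nullary.Decidable using (⌊_⌋; decidable-stable)

indicator : Bool → ℕ
indicator b = if b then 1 else 0

module _ {n : ℕ} {A : Set} where

  countB-∷ : (q : A → Bool) (x : A) (xs : List A) →
    countB {n} q (x ∷ xs) ≡ indicator (q x) + countB {n} q xs
  countB-∷ q x xs with q x
  ... | true  = refl
  ... | false = refl

  countB-++ : (q : A → Bool) (xs ys : List A) →
    countB {n} q (xs ++ ys) ≡ countB {n} q xs + countB {n} q ys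
  countB-++ q [] ys = refl
  countB-++ q (x ∷ xs) ys with q x
  ... | true  = cong suc (countB-++ q xs ys)
  ... | false = countB-++ q xs ys

  countB-≤-∷ : (q : A → Bool) (x : A) (xs : List A) → countB {n} q xs ≤ countB {n} q (x ∷ xs)
  countB-≤-∷ q x xs with q x
  ... | true  = n≤1+n _
  ... | false = ≤-refl

  rank : (q : A → Bool) (xs : List A) (i : Fin (length xs)) →
    q (L.lookup xs i) ≡ true → Fin (countB {n} q xs)
  rank q (x ∷ xs) zero qi with q x
  rank q (x ∷ xs) zero qi | true = zero
  rank q (x ∷ xs) zero () | false
  rank q (x ∷ xs) (suc i) qi with q x
  ... | true  = suc (rank q xs i qi)
  ... | false = rank q xs i qi

  rank-injective : (q : A → Bool) (xs : List A) (i j : Fin (length xs))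
    (qi : q (L.lookup xs i) ≡ true) (qj : q (L.lookup xs j) ≡ true) →
    rank q xs i qi ≡ rank q xs j qj → i ≡ j
  rank-injective q (x ∷ xs) zero zero qi qj eq = refl
  rank-injective q (x ∷ xs) zero (suc j) qi qj eq with q x
  rank-injective q (x ∷ xs) zero (suc j) qi qj () | true
  rank-injective q (x ∷ xs) zero (suc j) () qj eq | false
  rank-injective q (x ∷ xs) (suc i) zero qi qj eq with q x
  rank-injective q (x ∷ xs) (suc i) zero qi qj () | true
  rank-injective q (x ∷ xs) (suc i) zero qi () eq | false
  rank-injective q (x ∷ xs) (suc i) (suc j) qi qj eq with q x
  ... | true  = cong suc (rank-injective q xs i j qi qj (suc-injective eq))
  ... | false = cong suc (rank-injective q xs i j qi qj eq)

  injection⇒≤countB : (q : A → Bool) (xs : List A) {k : ℕ} (f : Fin k → Fin (length xs)) →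
    Injective _≡_ _≡_ f → (∀ i → q (L.lookup xs (f i)) ≡ true) → k ≤ countB {n} q xs
  injection⇒≤countB q xs f f-inj qf =
    injective⇒≤ {f = λ i → rank q xs (f i) (qf i)}
                (λ {i} {j} eq → f-inj (rank-injective q xs (f i) (f j) (qf i) (qf j) eq))

  countB-+-mono : (p q r t : A → Bool) →
    (∀ x → indicator (p x) + indicator (q x) ≤ indicator (r x) + indicator (t x)) →
    ∀ xs → countB {n} p xs + countB {n} q xs ≤ countB {n} r xs + countB {n} t xs
  countB-+-mono p q r t le [] = z≤n
  countB-+-mono p q r t le (x ∷ xs) = begin
    count p (x ∷ xs) + count q (x ∷ xs)
      ≡⟨ cong₂ _+_ (countB-∷ p x xs) (countB-∷ q x xs) ⟩
    (indicator (p x) + count p xs) + (indicator (q x) + count q xs)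
      ≡⟨ interchange +-commutativeSemigroup (indicator (p x)) (count p xs) (indicator (q x)) (count q xs) ⟩
    (indicator (p x) + indicator (q x)) + (count p xs + count q xs)
      ≤⟨ +-mono-≤ (le x) (countB-+-mono p q r t le xs) ⟩
    (indicator (r x) + indicator (t x)) + (count r xs + count t xs)
      ≡⟨ interchange +-commutativeSemigroup (indicator (r x)) (indicator (t x)) (count r xs) (count t xs) ⟩
    (indicator (r x) + count r xs) + (indicator (t x) + count t xs)
      ≡⟨ sym (cong₂ _+_ (countB-∷ r x xs) (countB-∷ t x xs)) ⟩
    count r (x ∷ xs) + count t (x ∷ xs) ∎
    where
      open ≤-Reasoning
      count : (A → Bool) → List A → ℕ
      count = countB {n}

∉⇒lookup≡false : ∀ {m x} {p : Subset m} → x ∉ p → lookup p x ≡ false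
∉⇒lookup≡false {x = x} {p} x∉p with lookup p x in eq
... | true  = ⊥-elim (x∉p (lookup⇒[]= x p eq))
... | false = refl

lookup-─ : ∀ {m} (p q : Subset m) (x : Fin m) → lookup (p ─ q) x ≡ lookup p x ∧ not (lookup q x)
lookup-─ (a ∷ p) (b ∷ q) zero with a | b
... | true  | true  = refl
... | true  | false = refl
... | false | true  = refl
... | false | false = refl
lookup-─ (_ ∷ p) (_ ∷ q) (suc x) = lookup-─ p q x

x∈p─q⇒x∉q : ∀ {m x} (p q : Subset m) → x ∈ p ─ q → x ∉ q
x∈p─q⇒x∉q (true ∷ p) (false ∷ q) here ()
x∈p─q⇒x∉q (_ ∷ p) (_ ∷ q) (there x∈p─q) (there x∈q) = x∈p─q⇒x∉q p q x∈p─q x∈q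

⊈⇒Nonempty─ : ∀ {m} (p q : Subset m) → ¬ p ⊆ q → Nonempty (p ─ q)
⊈⇒Nonempty─ p q p⊈q with nonempty? (p ─ q)
... | yes p─q≢∅ = p─q≢∅
... | no  p─q≡∅ = ⊥-elim (p⊈q λ {x} x∈p →
        decidable-stable (x ∈? q) λ x∉q → p─q≡∅ (x , x∈p∧x∉q⇒x∈p─q x∈p x∉q))

1≤∣p∣⇒Nonempty : ∀ {m} (p : Subset m) → 1 ≤ ∣ p ∣ → Nonempty p
1≤∣p∣⇒Nonempty {m} p 1≤∣p∣ with nonempty? p
... | yes p≢∅ = p≢∅
... | no  p≡∅ = ⊥-elim (m<n⇒n≢0 1≤∣p∣ (trans (cong ∣_∣ (Empty-unique p≡∅)) (∣⊥∣≡0 m)))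

-- a, b record whether one end of an edge lies in A, B; c, d the same for the other end.
posimodular-bits : (a b c d : Bool) →
  indicator ((a ∧ not b) xor (c ∧ not d)) + indicator ((b ∧ not a) xor (d ∧ not c))
    ≤ indicator (a xor c) + indicator (b xor d)
posimodular-bits a b c d = ≤ᵇ⇒≤ _ _ (by-cases a b c d)
  where
    by-cases : (a b c d : Bool) →
      T (indicator ((a ∧ not b) xor (c ∧ not d)) + indicator ((b ∧ not a) xor (d ∧ not c))
           ≤ᵇ indicator (a xor c) + indicator (b xor d))
    by-cases true  true  true  true  = _
    by-cases true  true  true  false = _
    by-cases true  true  false true  = _
    by-cases true  true  false false = _
    by-cases true  false true  true  = _
    by-cases true  false true  false = _
    by-cases true  false false true  = _
    by-cases true  false false false = _
    by-cases false true  true  true  = _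
    by-cases false true  true  false = _
    by-cases false true  false true  = _
    by-cases false true  false false = _
    by-cases false false true  true  = _
    by-cases false false true  false = _
    by-cases false false false true  = _
    by-cases false false false false = _

m+n≤o+o⇒m≤o⊎n≤o : ∀ {m n o} → m + n ≤ o + o → m ≤ o ⊎ n ≤ o
m+n≤o+o⇒m≤o⊎n≤o {m} {n} {o} m+n≤o+o with m ≤? o | n ≤? o
... | yes m≤o | _       = inj₁ m≤o
... | no  _   | yes n≤o = inj₂ n≤o
... | no  m≰o | no  n≰o = ⊥-elim (<⇒≱ (+-mono-< (≰⇒> m≰o) (≰⇒> n≰o)) m+n≤o+o)

module _ {n : ℕ} where

  countB-dropIdx-≤ : (q : Fin n × Fin n → Bool) (es : Edges n) (p : EIdx es → Bool) →
    countB {n} q (dropIdx es p) ≤ countB {n} q es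
  countB-dropIdx-≤ q [] p = z≤n
  countB-dropIdx-≤ q (e ∷ es) p with p zero
  ... | true = ≤-trans (countB-dropIdx-≤ q es _) (countB-≤-∷ {n} q e es)
  ... | false with q e
  ...   | true  = s≤s (countB-dropIdx-≤ q es _)
  ...   | false = countB-dropIdx-≤ q es _

  countB-dropIdx-<₁ : (q : Fin n × Fin n → Bool) (es : Edges n) (p : EIdx es → Bool) (i : EIdx es) →
    p i ≡ true → q (edge es i) ≡ true →
    suc (countB {n} q (dropIdx es p)) ≤ countB {n} q es
  countB-dropIdx-<₁ q (e ∷ es) p zero pi qi rewrite pi | qi = s≤s (countB-dropIdx-≤ q es _)
  countB-dropIdx-<₁ q (e ∷ es) p (suc i) pi qi with p zero
  ... | true = ≤-trans (countB-dropIdx-<₁ q es _ i pi qi) (countB-≤-∷ {n} q e es)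
  ... | false with q e
  ...   | true  = s≤s (countB-dropIdx-<₁ q es _ i pi qi)
  ...   | false = countB-dropIdx-<₁ q es _ i pi qi

  countB-dropIdx-<₂ : (q : Fin n × Fin n → Bool) (es : Edges n) (p : EIdx es → Bool) (i j : EIdx es) →
    i ≢ j → p i ≡ true → q (edge es i) ≡ true → p j ≡ true → q (edge es j) ≡ true →
    suc (suc (countB {n} q (dropIdx es p))) ≤ countB {n} q es
  countB-dropIdx-<₂ q (e ∷ es) p zero zero i≢j _ _ _ _ = ⊥-elim (i≢j refl)
  countB-dropIdx-<₂ q (e ∷ es) p zero (suc j) _ pi qi pj qj rewrite pi | qi =
    s≤s (countB-dropIdx-<₁ q es _ j pj qj)
  countB-dropIdx-<₂ q (e ∷ es) p (suc i) zero _ pi qi pj qj rewrite pj | qj =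
    s≤s (countB-dropIdx-<₁ q es _ i pi qi)
  countB-dropIdx-<₂ q (e ∷ es) p (suc i) (suc j) i≢j pi qi pj qj with p zero
  ... | true = ≤-trans (countB-dropIdx-<₂ q es _ i j (λ eq → i≢j (cong suc eq)) pi qi pj qj)
                       (countB-≤-∷ {n} q e es)
  ... | false with q e
  ...   | true  = s≤s (countB-dropIdx-<₂ q es _ i j (λ eq → i≢j (cong suc eq)) pi qi pj qj)
  ...   | false = countB-dropIdx-<₂ q es _ i j (λ eq → i≢j (cong suc eq)) pi qi pj qj

  crosses : Subset n → Fin n × Fin n → Bool
  crosses A e = lookup A (proj₁ e) xor lookup A (proj₂ e)

  walk-leaves : (es : Edges n) (A : Subset n) {u v : Fin n} {ps : List (EIdx es)} {vs : List (Fin n)} →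
    IsWalk es u v ps vs → u ∈ A → v ∉ A →
    Σ (EIdx es) λ e → e LM.∈ ps × crosses A (edge es e) ≡ true
  walk-leaves es A nil u∈A u∉A = ⊥-elim (u∉A u∈A)
  walk-leaves es A {u} (cons {w = w} e joins walk) u∈A v∉A with lookup A w in w∈?A
  ... | true  = let (c , c∈ps , c-crosses) = walk-leaves es A walk (lookup⇒[]= w A w∈?A) v∉A
                in c , there c∈ps , c-crosses
  ... | false = e , here refl , e-crosses joins
    where
      e-crosses : Joins (edge es e) u w → crosses A (edge es e) ≡ true
      e-crosses (inj₁ (refl , refl)) rewrite []=⇒lookup u∈A | w∈?A = refl
      e-crosses (inj₂ (refl , refl)) rewrite []=⇒lookup u∈A | w∈?A = refl

  SKConn⇒k≤cut : (es : Edges n) (s : Fin n) (k : ℕ) (A : Subset n) → SKConn es s k →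
    (a b : Fin n) → a ∈ A → b ∉ A → a ≢ s → b ≢ s → k ≤ cut es A
  SKConn⇒k≤cut es s k A (_ , _ , conn) a b a∈A b∉A a≢s b≢s =
    injection⇒≤countB {n} (crosses A) es leaving leaving-injective (λ i → proj₂ (proj₂ (leaves i)))
    where
      a≢b : a ≢ b
      a≢b refl = b∉A a∈A
      paths = conn a b a≢s b≢s a≢b
      leaves : ∀ i → Σ (EIdx es) λ e → e LM.∈ pedges (proj₁ paths i) × crosses A (edge es e) ≡ true
      leaves i = walk-leaves es A (walk (proj₁ paths i)) a∈A b∉A
      leaving : Fin k → EIdx es
      leaving i = proj₁ (leaves i)
      leaving-injective : Injective _≡_ _≡_ leaving
      leaving-injective {i} {j} eq with i ≟ j
      ... | yes i≡j = i≡j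
      ... | no i≢j  = ⊥-elim (proj₂ paths i j i≢j (leaving i) (proj₁ (proj₂ (leaves i)))
                        (subst (LM._∈ pedges (proj₁ paths j)) (sym eq) (proj₁ (proj₂ (leaves j)))))

  otherEnd∈⇒crosses : (s : Fin n) (A : Subset n) (e : Fin n × Fin n) → s ∉ A → Inc s e →
    otherEnd s e ∈ A → crosses A e ≡ true
  otherEnd∈⇒crosses s A (x , y) s∉A (inj₁ refl) y∈A with x ≟ x
  ... | no x≢x = ⊥-elim (x≢x refl)
  ... | yes _  rewrite ∉⇒lookup≡false s∉A | []=⇒lookup y∈A = refl
  otherEnd∈⇒crosses s A (x , y) s∉A (inj₂ refl) x∈A with x ≟ y
  ... | yes refl = ⊥-elim (s∉A x∈A)
  ... | no _     rewrite ∉⇒lookup≡false s∉A | []=⇒lookup x∈A = refl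

  cut-liftE : (es : Edges n) (s : Fin n) (A : Subset n) (i j : EIdx es) → i ≢ j → s ∉ A →
    Inc s (edge es i) → Inc s (edge es j) →
    otherEnd s (edge es i) ∈ A → otherEnd s (edge es j) ∈ A →
    suc (suc (cut (liftE es s i j) A)) ≤ cut es A
  cut-liftE es s A i j i≢j s∉A i-at-s j-at-s v∈A w∈A = begin
    suc (suc (cut (liftE es s i j) A))
      ≡⟨ cong (λ c → suc (suc c)) (countB-++ {n} (crosses A) (dropIdx es lifted) new) ⟩
    suc (suc (cut (dropIdx es lifted) A + countB {n} (crosses A) new))
      ≡⟨ cong (λ c → suc (suc (cut (dropIdx es lifted) A + c))) new-inside ⟩
    suc (suc (cut (dropIdx es lifted) A + 0))
      ≡⟨ cong (λ c → suc (suc c)) (+-identityʳ _) ⟩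
    suc (suc (cut (dropIdx es lifted) A))
      ≤⟨ countB-dropIdx-<₂ (crosses A) es lifted i j i≢j lifted-i
           (otherEnd∈⇒crosses s A _ s∉A i-at-s v∈A) lifted-j
           (otherEnd∈⇒crosses s A _ s∉A j-at-s w∈A) ⟩
    cut es A ∎
    where
      open ≤-Reasoning
      v w : Fin n
      v = otherEnd s (edge es i)
      w = otherEnd s (edge es j)
      lifted : EIdx es → Bool
      lifted x = ⌊ x ≟ i ⌋ ∨ ⌊ x ≟ j ⌋
      new : Edges n
      new = if ⌊ v ≟ w ⌋ then [] else (v , w) ∷ []
      ⌊≟⌋-refl : (x : EIdx es) → ⌊ x ≟ x ⌋ ≡ true
      ⌊≟⌋-refl x with x ≟ x
      ... | yes _   = refl
      ... | no x≢x = ⊥-elim (x≢x refl)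
      lifted-i : lifted i ≡ true
      lifted-i rewrite ⌊≟⌋-refl i = refl
      lifted-j : lifted j ≡ true
      lifted-j rewrite ⌊≟⌋-refl j = ∨-zeroʳ ⌊ j ≟ i ⌋
      new-inside : countB {n} (crosses A) new ≡ 0
      new-inside with ⌊ v ≟ w ⌋
      ... | true  = refl
      ... | false rewrite []=⇒lookup v∈A | []=⇒lookup w∈A = refl

  dangerous⇒¬SKConn-liftE : (es : Edges n) (s : Fin n) (k : ℕ) (B : Subset n) → Dangerous es s k B →
    (i j : EIdx es) → i ≢ j → Inc s (edge es i) → Inc s (edge es j) →
    otherEnd s (edge es i) ∈ B → otherEnd s (edge es j) ∈ B →
    ¬ SKConn (liftE es s i j) s k
  dangerous⇒¬SKConn-liftE es s k B (s∉B , (a , a∈B) , (b , b∉B , b≢s) , cut≤1+k)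
                          i j i≢j i-at-s j-at-s v∈B w∈B conn = 1+n≰n (begin
    suc (suc k)
      ≤⟨ s≤s (s≤s (SKConn⇒k≤cut (liftE es s i j) s k B conn a b a∈B b∉B a≢s b≢s)) ⟩
    suc (suc (cut (liftE es s i j) B))
      ≤⟨ cut-liftE es s B i j i≢j s∉B i-at-s j-at-s v∈B w∈B ⟩
    cut es B
      ≤⟨ cut≤1+k ⟩
    suc k ∎)
    where
      open ≤-Reasoning
      a≢s : a ≢ s
      a≢s refl = s∉B a∈B

  endsIn-dangerous⇒IndepL : (es : Edges n) (s : Fin n) (k : ℕ) (B : Subset n) → Dangerous es s k B →
    (J : Subset (length es)) →
    (∀ i → i ∈ J → IsLVert es s i × otherEnd s (edge es i) ∈ B) → IndepL es s k J
  endsIn-dangerous⇒IndepL es s k B B-dangerous J ends∈B =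
    (λ i i∈J → proj₁ (ends∈B i i∈J)) ,
    λ { i j i∈J j∈J (i≢j , i-at-s , j-at-s , conn) →
          dangerous⇒¬SKConn-liftE es s k B B-dangerous i j i≢j i-at-s j-at-s
            (proj₂ (ends∈B i i∈J)) (proj₂ (ends∈B j j∈J)) conn }

  MaxIndepL⇒⊈ : (es : Edges n) (s : Fin n) (k : ℕ) (I : Subset (length es)) (A B : Subset n) →
    MaxIndepL es s k I → Dangerous es s k B →
    (∀ i → i ∈ I → otherEnd s (edge es i) ∈ A) →
    (f : EIdx es) → IsLVert es s f → f ∉ I → otherEnd s (edge es f) ∈ B →
    ¬ A ⊆ B
  MaxIndepL⇒⊈ es s k I A B ((I-at-s , _) , I-maximal) B-dangerous I-ends f f-at-s f∉I f-end A⊆B =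
    I-maximal f f-at-s f∉I
      (endsIn-dangerous⇒IndepL es s k B B-dangerous (I ∪ ⁅ f ⁆) ends∈B)
    where
      ends∈B : ∀ i → i ∈ I ∪ ⁅ f ⁆ → IsLVert es s i × otherEnd s (edge es i) ∈ B
      ends∈B i i∈I∪f with x∈p∪q⁻ I ⁅ f ⁆ i∈I∪f
      ... | inj₁ i∈I = I-at-s i i∈I , A⊆B (I-ends i i∈I)
      ... | inj₂ i∈f with x∈⁅y⁆⇒x≡y f i∈f
      ...   | refl = f-at-s , f-end

  MaxIndepL⇒Nonempty─ : (es : Edges n) (s : Fin n) (k : ℕ) (I J : Subset (length es)) (A B : Subset n) →
    MaxIndepL es s k I → IndepL es s k J → (∀ e → e ∈ J → e ∉ I) → Nonempty J →
    Dangerous es s k B →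
    (∀ i → i ∈ I → otherEnd s (edge es i) ∈ A) → (∀ j → j ∈ J → otherEnd s (edge es j) ∈ B) →
    Nonempty (A ─ B)
  MaxIndepL⇒Nonempty─ es s k I J A B I-maximal (J-at-s , _) J∩I≡∅ (f , f∈J) B-dangerous I-ends J-ends =
    ⊈⇒Nonempty─ A B (MaxIndepL⇒⊈ es s k I A B I-maximal B-dangerous I-ends
                       f (J-at-s f f∈J) (J∩I≡∅ f f∈J) (J-ends f f∈J))

  cut-posimodular : (es : Edges n) (A B : Subset n) →
    cut es (A ─ B) + cut es (B ─ A) ≤ cut es A + cut es B
  cut-posimodular es A B =
    countB-+-mono {n} (crosses (A ─ B)) (crosses (B ─ A)) (crosses A) (crosses B) per-edge es
    where
      per-edge : ∀ e → indicator (crosses (A ─ B) e) + indicator (crosses (B ─ A) e)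
                         ≤ indicator (crosses A e) + indicator (crosses B e)
      per-edge (u , w) rewrite lookup-─ A B u | lookup-─ A B w | lookup-─ B A u | lookup-─ B A w =
        posimodular-bits (lookup A u) (lookup B u) (lookup A w) (lookup B w)

  dangerous-─ : (es : Edges n) (s : Fin n) (k : ℕ) (A B : Subset n) → s ∉ A → s ∉ B →
    Nonempty (A ─ B) → Nonempty (B ─ A) → cut es (A ─ B) ≤ suc k → Dangerous es s k (A ─ B)
  dangerous-─ es s k A B s∉A s∉B A─B≢∅ (y , y∈B─A) cut≤1+k =
    (λ s∈A─B → s∉A (p─q⊆p A B s∈A─B)) ,
    A─B≢∅ ,
    (y , (λ y∈A─B → x∈p─q⇒x∉q B A y∈B─A (p─q⊆p A B y∈A─B)) ,
         (λ { refl → s∉B (p─q⊆p B A y∈B─A) })) ,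
    cut≤1+k

  dangerous⇒cut-─-small : (es : Edges n) (s : Fin n) (k : ℕ) (A B : Subset n) →
    Dangerous es s k A → Dangerous es s k B →
    cut es (A ─ B) ≤ suc k ⊎ cut es (B ─ A) ≤ suc k
  dangerous⇒cut-─-small es s k A B (_ , _ , _ , cutA≤1+k) (_ , _ , _ , cutB≤1+k) =
    m+n≤o+o⇒m≤o⊎n≤o (≤-trans (cut-posimodular es A B) (+-mono-≤ cutA≤1+k cutB≤1+k))

lemma4p3 : {n : ℕ} (es : Edges n) (s : Fin n) (k : ℕ) →
    Loopless es → SKConn es s k → 2 ≤ k → 4 ≤ deg es s →
    (I₁ I₂ : Subset (length es)) →
    MaxIndepL es s k I₁ → MaxIndepL es s k I₂ →
    ((e : Fin (length es)) → e ∈ I₁ → e ∉ I₂) →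
    2 ≤ ∣ I₁ ∣ → 2 ≤ ∣ I₂ ∣ →
    (A₁ A₂ : Subset n) → Dangerous es s k A₁ → Dangerous es s k A₂ →
    ((e : Fin (length es)) → e ∈ I₁ → otherEnd s (edge es e) ∈ A₁) →
    ((e : Fin (length es)) → e ∈ I₂ → otherEnd s (edge es e) ∈ A₂) →
    Dangerous es s k (A₁ ─ A₂) ⊎ Dangerous es s k (A₂ ─ A₁)
lemma4p3 es s k _ _ _ _ I₁ I₂ M₁ M₂ I₁∩I₂≡∅ 2≤∣I₁∣ 2≤∣I₂∣ A₁ A₂ D₁ D₂ ends₁ ends₂
  = Sum.map (dangerous-─ es s k A₁ A₂ (proj₁ D₁) (proj₁ D₂) A₁─A₂≢∅ A₂─A₁≢∅)
            (dangerous-─ es s k A₂ A₁ (proj₁ D₂) (proj₁ D₁) A₂─A₁≢∅ A₁─A₂≢∅)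
            (dangerous⇒cut-─-small es s k A₁ A₂ D₁ D₂)
  where
    I₁≢∅ = 1≤∣p∣⇒Nonempty I₁ (≤-trans (s≤s z≤n) 2≤∣I₁∣)
    I₂≢∅ = 1≤∣p∣⇒Nonempty I₂ (≤-trans (s≤s z≤n) 2≤∣I₂∣)
    A₁─A₂≢∅ = MaxIndepL⇒Nonempty─ es s k I₁ I₂ A₁ A₂ M₁ (proj₁ M₂) (λ e e∈I₂ e∈I₁ → I₁∩I₂≡∅ e e∈I₁ e∈I₂)
                I₂≢∅ D₂ ends₁ ends₂
    A₂─A₁≢∅ = MaxIndepL⇒Nonempty─ es s k I₂ I₁ A₂ A₁ M₂ (proj₁ M₁) I₁∩I₂≡∅ I₁≢∅ D₁ ends₂ ends₁
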